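{- Let $\Psi:\mathbb{Q}[x]\to\mathbb{Q}$ be the linear form defined by $\Psi(x^n)=B_n$ for all $n\ge 0$, where the Bernoulli numbers $B_n$ are defined by $\frac{t}{e^t-1}=\sum_{n\ge0}B_n\frac{t^n}{n!}$. Then for every integer $n\ge 0$ with $n\neq 1$, $$\Psi\big(x^n(x+1)^n\big)=\Psi\big((x+1)^n(x+2)^n\big).$$
   Context: With this convention $B_1=-1/2$ and $B_m=0$ for odd $m\ge 3$. -}

module Defs where

open import Data.Nat as ℕ using (ℕ; zero; suc)
open import Data.Nat.Combinatorics using (_C_)
open import Data.Rational using (ℚ; 0ℚ; 1ℚ; _+_; _*_; -_; _/_)
open import Data.List using (List; []; _∷_; length; reverse; zipWith; foldr; replicate; _++_)
open import Data.Integer using (+_)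

fromℕ : ℕ → ℚ
fromℕ n = + n / 1

-- Bernoulli numbers (convention t/(e^t-1) = Σ B_n t^n/n!, so B₁ = -1/2),
-- via the equivalent defining recurrence obtained by multiplying
-- the generating function by (e^t - 1)/t :
--   B₀ = 1,  Σ_{k=0}^{m} C(m+1,k) B_k = 0  for m ≥ 1, i.e.
--   B_m = -(1/(m+1)) Σ_{k<m} C(m+1,k) B_k.
-- bernList m = [B₀, …, B_{m-1}]
private
  sumIdx : ℕ → List ℚ → (ℕ → ℚ → ℚ) → ℚ
  sumIdx i [] f = 0ℚ
  sumIdx i (b ∷ bs) f = f i b + sumIdx (suc i) bs f

  nextB : List ℚ → ℚ
  nextB bs = - ((+ 1 / suc m) * sumIdx 0 bs (λ k b → fromℕ (suc m C k) * b))
    where m = length bs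

bernList : ℕ → List ℚ
bernList zero = []
bernList (suc zero) = 1ℚ ∷ []
bernList (suc (suc n)) = let bs = bernList (suc n) in bs ++ (nextB bs ∷ [])

nth : List ℚ → ℕ → ℚ
nth [] _ = 0ℚ
nth (x ∷ _) zero = x
nth (_ ∷ xs) (suc n) = nth xs n

B : ℕ → ℚ
B n = nth (bernList (suc n)) n

-- Polynomials over ℚ as coefficient lists (constant term first)
Poly : Set
Poly = List ℚ

addP : Poly → Poly → Poly
addP [] q = q
addP p [] = p
addP (a ∷ p) (b ∷ q) = (a + b) ∷ addP p q

scaleP : ℚ → Poly → Poly
scaleP c [] = []
scaleP c (a ∷ p) = c * a ∷ scaleP c p

mulP : Poly → Poly → Poly
mulP [] q = []
mulP (a ∷ p) q = addP (scaleP a q) (0ℚ ∷ mulP p q)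

powP : Poly → ℕ → Poly
powP p zero = 1ℚ ∷ []
powP p (suc n) = mulP p (powP p n)

X X+1 X+2 : Poly
X = 0ℚ ∷ 1ℚ ∷ []
X+1 = 1ℚ ∷ 1ℚ ∷ []
X+2 = fromℕ 2 ∷ 1ℚ ∷ []

Ψ : Poly → ℚ
Ψ p = go 0 p
  where
  go : ℕ → Poly → ℚ
  go i [] = 0ℚ
  go i (a ∷ p) = a * B i + go (suc i) p

{-# OPTIONS --safe #-}
-- For a ≥ 2 the
-- Bernoulli recurrence Σₖ C(a,k) Bₖ = Bₐ says Ψ((x+1)ᵃ) = Ψ(xᵃ).  Both
-- F(a,b) = Ψ(xᵃ(x+1)ᵇ) and G(a,b) = Ψ((x+1)ᵃ(x+2)ᵇ) satisfy H(a,b+1) = H(a,b) + H(a+1,b),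
-- since x+1 = x + 1 and x+2 = (x+1) + 1.  They agree at b = 0 for every a ≥ 2, hence
-- for all b and all a ≥ 2, and a = b = n is the theorem.
module Submission where

open import Defs
open import Data.Nat using (ℕ)
open import Relation.Binary.PropositionalEquality using (_≡_; _≢_)

open import Algebra.Bundles using (CommutativeMonoid)
open import Data.Empty using (⊥-elim)
open import Data.Fin using (toℕ)
open import Data.Fin.Properties using (toℕ<n; toℕ-inject₁; toℕ-fromℕ)
import Data.Integer as ℤ
import Data.Integer.Properties as ℤₚ
open import Data.List using (List; []; _∷_; _++_; length)
open import Data.List.Properties using (length-++)
open import Data.Nat as ℕ using (zero; suc; _<_; s≤s)
import Data.Nat.Properties as ℕₚ
open import Data.Nat.Combinatorics
  using (_C_; nCn≡1; nC1≡n; nCk≡nC[n∸k]; nCk+nC[k+1]≡[n+1]C[k+1]; k>n⇒nCk≡0)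
import Data.Nat.Coprimality as Coprime
open import Data.Rational using (ℚ; 0ℚ; 1ℚ; _+_; _*_; -_; _/_; mkℚ)
open import Data.Rational.Properties
open import Data.Rational.Solver using (module +-*-Solver)
open import Data.Sum using ([_,_]′)
open import Function using (_∘_)
open import Relation.Binary.PropositionalEquality
  using (refl; sym; trans; cong; cong₂; subst; module ≡-Reasoning)

open import Algebra.Properties.CommutativeSemigroup
  (CommutativeMonoid.commutativeSemigroup +-0-commutativeMonoid)
  using () renaming (interchange to +-interchange)
open import Algebra.Properties.CommutativeMonoid.Sum +-0-commutativeMonoid
  using (sum-syntax; ∑-distrib-+; sum-cong-≗; sum-init-last)

open +-*-Solver using (solve; _:+_; _:*_; :-_; _:=_; con)
open ≡-Reasoning

fromℕ≡mkℚ : ∀ n → fromℕ n ≡ mkℚ (ℤ.+ n) 0 (Coprime.sym (Coprime.1-coprimeTo n))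
fromℕ≡mkℚ n = normalize-coprime (Coprime.sym (Coprime.1-coprimeTo n))

fromℕ-+ : ∀ m n → fromℕ (m ℕ.+ n) ≡ fromℕ m + fromℕ n
fromℕ-+ m n = trans
  (cong (_/ 1) (trans (ℤₚ.pos-+ m n)
    (sym (cong₂ ℤ._+_ (ℤₚ.*-identityʳ (ℤ.+ m)) (ℤₚ.*-identityʳ (ℤ.+ n))))))
  (sym (cong₂ _+_ (fromℕ≡mkℚ m) (fromℕ≡mkℚ n)))

fromℕ[1+n]*1/[1+n]≡1 : ∀ n → fromℕ (suc n) * (ℤ.+ 1 / suc n) ≡ 1ℚ
fromℕ[1+n]*1/[1+n]≡1 n = trans
  (cong₂ _*_ (fromℕ≡mkℚ (suc n)) (normalize-coprime (Coprime.1-coprimeTo (suc n))))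
  (*-inverseʳ (mkℚ (ℤ.+ suc n) 0 (Coprime.sym (Coprime.1-coprimeTo (suc n)))))

x+n*-[q*x]≡0 : ∀ n q x → n * q ≡ 1ℚ → x + n * - (q * x) ≡ 0ℚ
x+n*-[q*x]≡0 n q x nq≡1 = begin
  x + n * - (q * x)
    ≡⟨ solve 3 (λ n q x → x :+ n :* (:- (q :* x)) := x :+ (:- ((n :* q) :* x))) refl n q x ⟩
  x + - ((n * q) * x)  ≡⟨ cong (λ t → x + - (t * x)) nq≡1 ⟩
  x + - (1ℚ * x)       ≡⟨ cong (λ t → x + - t) (*-identityˡ x) ⟩
  x + - x              ≡⟨ +-inverseʳ x ⟩
  0ℚ ∎

suc[n]Cn≡suc[n] : ∀ n → suc n C n ≡ suc n
suc[n]Cn≡suc[n] n = begin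
  suc n C n             ≡⟨ nCk≡nC[n∸k] (ℕₚ.n≤1+n n) ⟩
  suc n C (suc n ℕ.∸ n) ≡⟨ cong (suc n C_) (ℕₚ.m+n∸n≡m 1 n) ⟩
  suc n C 1             ≡⟨ nC1≡n (suc n) ⟩
  suc n ∎

∑-init-last : ∀ n (f : ℕ → ℚ) → ∑[ k < suc n ] f (toℕ k) ≡ ∑[ k < n ] f (toℕ k) + f n
∑-init-last n f = trans (sum-init-last {n} (f ∘ toℕ))
  (cong₂ _+_ (sum-cong-≗ {n} (cong f ∘ toℕ-inject₁)) (cong f (toℕ-fromℕ n)))

∑-pascal : ∀ a (μ : ℕ → ℚ) →
  ∑[ k < suc (suc a) ] (fromℕ (suc a C toℕ k) * μ (toℕ k))
    ≡ ∑[ k < suc a ] (fromℕ (a C toℕ k) * μ (toℕ k))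
      + ∑[ k < suc a ] (fromℕ (a C toℕ k) * μ (suc (toℕ k)))
-- Both sides begin with the same summand: C(a+1,0) and C(a,0) both compute to 1.
∑-pascal a μ = begin
  c 0 * μ 0 + ∑[ k < suc a ] (fromℕ (suc a C suc (toℕ k)) * ν (toℕ k))
    ≡⟨ cong (c 0 * μ 0 +_) (sum-cong-≗ {suc a} (pascal ∘ toℕ)) ⟩
  c 0 * μ 0 + ∑[ k < suc a ] (u (toℕ k) + v (toℕ k))
    ≡⟨ cong (c 0 * μ 0 +_) (∑-distrib-+ {suc a} (u ∘ toℕ) (v ∘ toℕ)) ⟩
  c 0 * μ 0 + (∑[ k < suc a ] u (toℕ k) + ∑[ k < suc a ] v (toℕ k))
    ≡⟨ cong (λ t → c 0 * μ 0 + (U + t)) (∑-init-last a v) ⟩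
  c 0 * μ 0 + (U + (V + fromℕ (a C suc a) * ν a))
    ≡⟨ cong (λ t → c 0 * μ 0 + (U + (V + fromℕ t * ν a))) (k>n⇒nCk≡0 (ℕₚ.n<1+n a)) ⟩
  c 0 * μ 0 + (U + (V + 0ℚ * ν a))
    ≡⟨ solve 4 (λ x s t y → x :+ (s :+ (t :+ con 0ℚ :* y)) := (x :+ t) :+ s) refl
         (c 0 * μ 0) U V (ν a) ⟩
  (c 0 * μ 0 + V) + U ∎
  where
  ν : ℕ → ℚ
  ν = μ ∘ suc
  c u v : ℕ → ℚ
  c k = fromℕ (a C k)
  u k = c k * ν k
  v k = c (suc k) * ν k
  U V : ℚ
  U = ∑[ k < suc a ] u (toℕ k)
  V = ∑[ k < a ] v (toℕ k)
  pascal : ∀ k → fromℕ (suc a C suc k) * ν k ≡ u k + v k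
  pascal k = begin
    fromℕ (suc a C suc k) * ν k
      ≡⟨ cong (λ t → fromℕ t * ν k) (nCk+nC[k+1]≡[n+1]C[k+1] a k) ⟨
    fromℕ (a C k ℕ.+ a C suc k) * ν k
      ≡⟨ cong (_* ν k) (fromℕ-+ (a C k) (a C suc k)) ⟩
    (c k + c (suc k)) * ν k
      ≡⟨ *-distribʳ-+ (ν k) (c k) (c (suc k)) ⟩
    u k + v k ∎

-- Λ μ i p is the value at xⁱ p of the linear form sending xⁿ to μ n.
Λ : (ℕ → ℚ) → ℕ → Poly → ℚ
Λ μ i []      = 0ℚ
Λ μ i (a ∷ p) = a * μ i + Λ μ (suc i) p

Λ-unique : {S : ℕ → Poly → ℚ} (μ : ℕ → ℚ) →
  (∀ i → S i [] ≡ 0ℚ) → (∀ i a p → S i (a ∷ p) ≡ a * μ i + S (suc i) p) →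
  ∀ i p → S i p ≡ Λ μ i p
Λ-unique μ nil cons i []          = nil i
Λ-unique {S} μ nil cons i (a ∷ p) =
  trans (cons i a p) (cong (a * μ i +_) (Λ-unique {S} μ nil cons (suc i) p))

-- Ψ is computed by a local helper that cannot be named here.  Its defining equations
-- hold by refl, and once the index 0 is abstracted, unification solves the implicit S of
-- Λ-unique with that helper; Λ-unique is instantiated first so that S does not depend on i.
Ψ≡ΛB : ∀ p → Ψ p ≡ Λ B 0 p
Ψ≡ΛB with Λ-unique B (λ _ → refl) (λ _ _ _ → refl) | 0
... | go≡Λ | i = λ p → go≡Λ i p

Λ-cong : ∀ {μ ν : ℕ → ℚ} → (∀ k → μ k ≡ ν k) → ∀ i p → Λ μ i p ≡ Λ ν i p
Λ-cong μ≡ν i []      = refl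
Λ-cong μ≡ν i (a ∷ p) = cong₂ _+_ (cong (a *_) (μ≡ν i)) (Λ-cong μ≡ν (suc i) p)

Λ-+ : ∀ (μ ν : ℕ → ℚ) i p → Λ (λ k → μ k + ν k) i p ≡ Λ μ i p + Λ ν i p
Λ-+ μ ν i []      = sym (+-identityˡ 0ℚ)
Λ-+ μ ν i (a ∷ p) = begin
  a * (μ i + ν i) + Λ (λ k → μ k + ν k) (suc i) p
    ≡⟨ cong₂ _+_ (*-distribˡ-+ a (μ i) (ν i)) (Λ-+ μ ν (suc i) p) ⟩
  (a * μ i + a * ν i) + (Λ μ (suc i) p + Λ ν (suc i) p)
    ≡⟨ +-interchange (a * μ i) (a * ν i) (Λ μ (suc i) p) (Λ ν (suc i) p) ⟩
  (a * μ i + Λ μ (suc i) p) + (a * ν i + Λ ν (suc i) p) ∎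

Λ-∘suc : ∀ (μ : ℕ → ℚ) i p → Λ (μ ∘ suc) i p ≡ Λ μ (suc i) p
Λ-∘suc μ i []      = refl
Λ-∘suc μ i (a ∷ p) = cong (a * μ (suc i) +_) (Λ-∘suc μ (suc i) p)

Λ-addP : ∀ μ i p q → Λ μ i (addP p q) ≡ Λ μ i p + Λ μ i q
Λ-addP μ i []      q       = sym (+-identityˡ _)
Λ-addP μ i (a ∷ p) []      = sym (+-identityʳ _)
Λ-addP μ i (a ∷ p) (b ∷ q) = begin
  (a + b) * μ i + Λ μ (suc i) (addP p q)
    ≡⟨ cong₂ _+_ (*-distribʳ-+ (μ i) a b) (Λ-addP μ (suc i) p q) ⟩
  (a * μ i + b * μ i) + (Λ μ (suc i) p + Λ μ (suc i) q)
    ≡⟨ +-interchange (a * μ i) (b * μ i) (Λ μ (suc i) p) (Λ μ (suc i) q) ⟩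
  (a * μ i + Λ μ (suc i) p) + (b * μ i + Λ μ (suc i) q) ∎

Λ-scaleP : ∀ μ i c p → Λ μ i (scaleP c p) ≡ c * Λ μ i p
Λ-scaleP μ i c []      = sym (*-zeroʳ c)
Λ-scaleP μ i c (a ∷ p) = begin
  c * a * μ i + Λ μ (suc i) (scaleP c p)
    ≡⟨ cong₂ _+_ (*-assoc c a (μ i)) (Λ-scaleP μ (suc i) c p) ⟩
  c * (a * μ i) + c * Λ μ (suc i) p
    ≡⟨ *-distribˡ-+ c (a * μ i) (Λ μ (suc i) p) ⟨
  c * (a * μ i + Λ μ (suc i) p) ∎

Λ-mulP : ∀ μ i p q → Λ μ i (mulP p q) ≡ Λ (λ k → Λ μ k q) i p
Λ-mulP μ i []      q = refl
Λ-mulP μ i (a ∷ p) q = begin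
  Λ μ i (addP (scaleP a q) (0ℚ ∷ mulP p q))
    ≡⟨ Λ-addP μ i (scaleP a q) (0ℚ ∷ mulP p q) ⟩
  Λ μ i (scaleP a q) + (0ℚ * μ i + Λ μ (suc i) (mulP p q))
    ≡⟨ cong₂ _+_ (Λ-scaleP μ i a q) (cong (_+ Λ μ (suc i) (mulP p q)) (*-zeroˡ (μ i))) ⟩
  a * Λ μ i q + (0ℚ + Λ μ (suc i) (mulP p q))
    ≡⟨ cong (a * Λ μ i q +_) (trans (+-identityˡ _) (Λ-mulP μ (suc i) p q)) ⟩
  a * Λ μ i q + Λ (λ k → Λ μ k q) (suc i) p ∎

Λ-1 : ∀ (μ : ℕ → ℚ) i → Λ μ i (1ℚ ∷ []) ≡ μ i
Λ-1 μ i = trans (+-identityʳ _) (*-identityˡ (μ i))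

Λ-linear : ∀ (μ : ℕ → ℚ) i a b → Λ μ i (a ∷ b ∷ []) ≡ a * μ i + b * μ (suc i)
Λ-linear μ i a b = cong (a * μ i +_) (+-identityʳ _)

Λ-X* : ∀ μ i p → Λ μ i (mulP X p) ≡ Λ μ (suc i) p
Λ-X* μ i p = begin
  Λ μ i (mulP X p)                   ≡⟨ Λ-mulP μ i X p ⟩
  Λ (λ k → Λ μ k p) i X              ≡⟨ Λ-linear (λ k → Λ μ k p) i 0ℚ 1ℚ ⟩
  0ℚ * Λ μ i p + 1ℚ * Λ μ (suc i) p
    ≡⟨ solve 2 (λ x y → con 0ℚ :* x :+ con 1ℚ :* y := y) refl (Λ μ i p) (Λ μ (suc i) p) ⟩
  Λ μ (suc i) p ∎

Λ-X+1* : ∀ μ i p → Λ μ i (mulP X+1 p) ≡ Λ μ i p + Λ μ (suc i) p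
Λ-X+1* μ i p = begin
  Λ μ i (mulP X+1 p)                 ≡⟨ Λ-mulP μ i X+1 p ⟩
  Λ (λ k → Λ μ k p) i X+1            ≡⟨ Λ-linear (λ k → Λ μ k p) i 1ℚ 1ℚ ⟩
  1ℚ * Λ μ i p + 1ℚ * Λ μ (suc i) p
    ≡⟨ cong₂ _+_ (*-identityˡ (Λ μ i p)) (*-identityˡ (Λ μ (suc i) p)) ⟩
  Λ μ i p + Λ μ (suc i) p ∎

Λ-X+2* : ∀ μ i p → Λ μ i (mulP X+2 p) ≡ Λ μ i p + (Λ μ i p + Λ μ (suc i) p)
Λ-X+2* μ i p = begin
  Λ μ i (mulP X+2 p)                      ≡⟨ Λ-mulP μ i X+2 p ⟩
  Λ (λ k → Λ μ k p) i X+2                 ≡⟨ Λ-linear (λ k → Λ μ k p) i (fromℕ 2) 1ℚ ⟩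
  fromℕ 2 * Λ μ i p + 1ℚ * Λ μ (suc i) p
    ≡⟨ solve 2 (λ x y → (con 1ℚ :+ con 1ℚ) :* x :+ con 1ℚ :* y := x :+ (x :+ y)) refl
         (Λ μ i p) (Λ μ (suc i) p) ⟩
  Λ μ i p + (Λ μ i p + Λ μ (suc i) p) ∎

Λ-X^ : ∀ μ i a → Λ μ i (powP X a) ≡ μ (i ℕ.+ a)
Λ-X^ μ i zero    = trans (Λ-1 μ i) (cong μ (sym (ℕₚ.+-identityʳ i)))
Λ-X^ μ i (suc a) = begin
  Λ μ i (mulP X (powP X a)) ≡⟨ Λ-X* μ i (powP X a) ⟩
  Λ μ (suc i) (powP X a)    ≡⟨ Λ-X^ μ (suc i) a ⟩
  μ (suc i ℕ.+ a)           ≡⟨ cong μ (ℕₚ.+-suc i a) ⟨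
  μ (i ℕ.+ suc a) ∎

Λ-forward : ∀ (μ : ℕ → ℚ) i p → Λ (λ k → μ k + μ (suc k)) i p ≡ Λ μ i (mulP X+1 p)
Λ-forward μ i p = begin
  Λ (λ k → μ k + μ (suc k)) i p  ≡⟨ Λ-+ μ (μ ∘ suc) i p ⟩
  Λ μ i p + Λ (μ ∘ suc) i p      ≡⟨ cong (Λ μ i p +_) (Λ-∘suc μ i p) ⟩
  Λ μ i p + Λ μ (suc i) p        ≡⟨ Λ-X+1* μ i p ⟨
  Λ μ i (mulP X+1 p) ∎

Λ-binomial : ∀ a (μ : ℕ → ℚ) →
  Λ μ 0 (powP X+1 a) ≡ ∑[ k < suc a ] (fromℕ (a C toℕ k) * μ (toℕ k))
Λ-binomial zero    μ = refl
Λ-binomial (suc a) μ = begin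
  Λ μ 0 (powP X+1 (suc a))
    ≡⟨ Λ-X+1* μ 0 (powP X+1 a) ⟩
  Λ μ 0 (powP X+1 a) + Λ μ 1 (powP X+1 a)
    ≡⟨ cong (Λ μ 0 (powP X+1 a) +_) (Λ-∘suc μ 0 (powP X+1 a)) ⟨
  Λ μ 0 (powP X+1 a) + Λ (μ ∘ suc) 0 (powP X+1 a)
    ≡⟨ cong₂ _+_ (Λ-binomial a μ) (Λ-binomial a (μ ∘ suc)) ⟩
  ∑[ k < suc a ] (fromℕ (a C toℕ k) * μ (toℕ k))
    + ∑[ k < suc a ] (fromℕ (a C toℕ k) * μ (suc (toℕ k)))
    ≡⟨ ∑-pascal a μ ⟨
  ∑[ k < suc (suc a) ] (fromℕ (suc a C toℕ k) * μ (toℕ k)) ∎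

Λ-translation : ∀ (μ : ℕ → ℚ) → (∀ a → Λ μ 0 (powP X+1 (2 ℕ.+ a)) ≡ μ (2 ℕ.+ a)) →
  ∀ b a → Λ (λ k → Λ μ k (powP X+2 b)) 0 (powP X+1 (2 ℕ.+ a))
        ≡ Λ μ (2 ℕ.+ a) (powP X+1 b)
Λ-translation μ base zero a = begin
  Λ (λ k → Λ μ k (1ℚ ∷ [])) 0 P ≡⟨ Λ-cong (Λ-1 μ) 0 P ⟩
  Λ μ 0 P                       ≡⟨ base a ⟩
  μ (2 ℕ.+ a)                   ≡⟨ Λ-1 μ (2 ℕ.+ a) ⟨
  Λ μ (2 ℕ.+ a) (1ℚ ∷ []) ∎
  where
  P : Poly
  P = powP X+1 (2 ℕ.+ a)
Λ-translation μ base (suc b) a = begin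
  Λ (λ k → Λ μ k (powP X+2 (suc b))) 0 P
    ≡⟨ Λ-cong (λ k → Λ-X+2* μ k (powP X+2 b)) 0 P ⟩
  Λ (λ k → ν k + (ν k + ν (suc k))) 0 P
    ≡⟨ Λ-+ ν (λ k → ν k + ν (suc k)) 0 P ⟩
  Λ ν 0 P + Λ (λ k → ν k + ν (suc k)) 0 P
    ≡⟨ cong (Λ ν 0 P +_) (Λ-forward ν 0 P) ⟩
  Λ ν 0 P + Λ ν 0 (powP X+1 (3 ℕ.+ a))
    ≡⟨ cong₂ _+_ (Λ-translation μ base b a) (Λ-translation μ base b (suc a)) ⟩
  Λ μ (2 ℕ.+ a) (powP X+1 b) + Λ μ (3 ℕ.+ a) (powP X+1 b)
    ≡⟨ Λ-X+1* μ (2 ℕ.+ a) (powP X+1 b) ⟨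
  Λ μ (2 ℕ.+ a) (powP X+1 (suc b)) ∎
  where
  P : Poly
  P = powP X+1 (2 ℕ.+ a)
  ν : ℕ → ℚ
  ν k = Λ μ k (powP X+2 b)

nth-++ : ∀ (xs ys : List ℚ) {j} → j < length xs → nth (xs ++ ys) j ≡ nth xs j
nth-++ (x ∷ xs) ys {zero}  _         = refl
nth-++ (x ∷ xs) ys {suc j} (s≤s j<n) = nth-++ xs ys j<n

nth-++-length : ∀ (xs : List ℚ) y {n} → length xs ≡ n → nth (xs ++ y ∷ []) n ≡ y
nth-++-length []       y refl = refl
nth-++-length (x ∷ xs) y refl = nth-++-length xs y refl

length-bernList : ∀ n → length (bernList n) ≡ n
length-bernList zero          = refl
length-bernList (suc zero)    = refl
length-bernList (suc (suc n)) = begin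
  length (bernList (suc n) ++ _ ∷ []) ≡⟨ length-++ (bernList (suc n)) ⟩
  length (bernList (suc n)) ℕ.+ 1     ≡⟨ cong (ℕ._+ 1) (length-bernList (suc n)) ⟩
  suc n ℕ.+ 1                         ≡⟨ ℕₚ.+-comm (suc n) 1 ⟩
  suc (suc n) ∎

nth-bernList : ∀ n {j} → j < n → nth (bernList n) j ≡ B j
nth-bernList (suc zero)    {zero}  _     = refl
nth-bernList (suc zero)    {suc j} (s≤s ())
nth-bernList (suc (suc n)) {j}     j<2+n =
  [ (λ j<1+n → trans
        (nth-++ (bernList (suc n)) _ (subst (j <_) (sym (length-bernList (suc n))) j<1+n))
        (nth-bernList (suc n) j<1+n))
  , (λ { refl → refl })
  ]′ (ℕₚ.m<1+n⇒m<n∨m≡n j<2+n)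

-- Public copies of the private helpers sumIdx and nextB of Defs.
weightedSum : ℕ → List ℚ → (ℕ → ℚ → ℚ) → ℚ
weightedSum i []       f = 0ℚ
weightedSum i (b ∷ bs) f = f i b + weightedSum (suc i) bs f

nextBernoulli : List ℚ → ℚ
nextBernoulli bs =
  - ((ℤ.+ 1 / suc (length bs)) * weightedSum 0 bs (λ j b → fromℕ (suc (length bs) C j) * b))

weightedSum-unique : {S : ℕ → List ℚ → (ℕ → ℚ → ℚ) → ℚ} →
  (∀ i f → S i [] f ≡ 0ℚ) →
  (∀ i b bs f → S i (b ∷ bs) f ≡ f i b + S (suc i) bs f) →
  ∀ i bs f → S i bs f ≡ weightedSum i bs f
weightedSum-unique nil cons i []         f = nil i f
weightedSum-unique {S} nil cons i (b ∷ bs) f =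
  trans (cons i b bs f) (cong (f i b +_) (weightedSum-unique {S} nil cons (suc i) bs f))

weightedSum-∑ : ∀ i bs f →
  weightedSum i bs f ≡ ∑[ j < length bs ] f (i ℕ.+ toℕ j) (nth bs (toℕ j))
weightedSum-∑ i []       f = refl
weightedSum-∑ i (b ∷ bs) f = cong₂ _+_ (cong (λ t → f t b) (sym (ℕₚ.+-identityʳ i)))
  (trans (weightedSum-∑ (suc i) bs f)
         (sum-cong-≗ {length bs} (λ j → cong (λ t → f t (nth bs (toℕ j)))
                                             (sym (ℕₚ.+-suc i (toℕ j))))))

-- As for Ψ≡ΛB; the weights and the factor 1/(m+1) are abstracted before the index 0 so
-- that 0 no longer occurs anywhere else in the goal.
B-suc : ∀ k → B (suc k) ≡ nextBernoulli (bernList (suc k))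
B-suc k with weightedSum-unique (λ _ _ → refl) (λ _ _ _ _ → refl) | bernList (suc k) in bernList≡bs
... | sumIdx≡weightedSum | bs
      with (λ (j : ℕ) (b : ℚ) → fromℕ (suc (length bs) C j) * b) | ℤ.+ 1 / suc (length bs)
... | f | q with 0
... | i = trans
  (nth-++-length bs _ (trans (cong length (sym bernList≡bs)) (length-bernList (suc k))))
  (cong (λ s → - (q * s)) (sumIdx≡weightedSum i bs f))

∑CB : ℕ → ℕ → ℚ
∑CB m k = ∑[ j < k ] (fromℕ (m C toℕ j) * B (toℕ j))

B-suc-∑CB : ∀ m → B (suc m) ≡ - ((ℤ.+ 1 / suc (suc m)) * ∑CB (suc (suc m)) (suc m))
B-suc-∑CB m = begin
  B (suc m)
    ≡⟨ B-suc m ⟩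
  nextBernoulli bs
    ≡⟨ cong (λ s → - ((ℤ.+ 1 / suc (length bs)) * s)) (weightedSum-∑ 0 bs _) ⟩
  formula (length bs) (nth bs)
    ≡⟨ cong (λ L → formula L (nth bs)) (length-bernList (suc m)) ⟩
  formula (suc m) (nth bs)
    ≡⟨ cong (λ s → - ((ℤ.+ 1 / suc (suc m)) * s)) (sum-cong-≗ {suc m} nth-bs≡B) ⟩
  formula (suc m) B ∎
  where
  bs : List ℚ
  bs = bernList (suc m)
  formula : ℕ → (ℕ → ℚ) → ℚ
  formula L β = - ((ℤ.+ 1 / suc L) * ∑[ j < L ] (fromℕ (suc L C toℕ j) * β (toℕ j)))
  nth-bs≡B : ∀ j → fromℕ (suc (suc m) C toℕ j) * nth bs (toℕ j)
                 ≡ fromℕ (suc (suc m) C toℕ j) * B (toℕ j)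
  nth-bs≡B j = cong (fromℕ (suc (suc m) C toℕ j) *_) (nth-bernList (suc m) (toℕ<n j))

bernoulli-recurrence : ∀ n → ∑CB (suc (suc n)) (suc (suc n)) ≡ 0ℚ
bernoulli-recurrence n = begin
  ∑CB (suc (suc n)) (suc (suc n))
    ≡⟨ ∑-init-last (suc n) (λ j → fromℕ (suc (suc n) C j) * B j) ⟩
  s + fromℕ (suc (suc n) C suc n) * B (suc n)
    ≡⟨ cong (λ t → s + fromℕ t * B (suc n)) (suc[n]Cn≡suc[n] (suc n)) ⟩
  s + N * B (suc n)
    ≡⟨ cong (λ t → s + N * t) (B-suc-∑CB n) ⟩
  s + N * - ((ℤ.+ 1 / suc (suc n)) * s)
    ≡⟨ x+n*-[q*x]≡0 N (ℤ.+ 1 / suc (suc n)) s (fromℕ[1+n]*1/[1+n]≡1 (suc n)) ⟩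
  0ℚ ∎
  where
  N s : ℚ
  N = fromℕ (suc (suc n))
  s = ∑CB (suc (suc n)) (suc n)

ΛB-binomial : ∀ a → Λ B 0 (powP X+1 (2 ℕ.+ a)) ≡ B (2 ℕ.+ a)
ΛB-binomial a = begin
  Λ B 0 (powP X+1 n)              ≡⟨ Λ-binomial n B ⟩
  ∑CB n (suc n)                   ≡⟨ ∑-init-last n (λ k → fromℕ (n C k) * B k) ⟩
  ∑CB n n + fromℕ (n C n) * B n
    ≡⟨ cong₂ _+_ (bernoulli-recurrence a) (cong (λ t → fromℕ t * B n) (nCn≡1 n)) ⟩
  0ℚ + 1ℚ * B n                   ≡⟨ trans (+-identityˡ _) (*-identityˡ (B n)) ⟩
  B n ∎
  where
  n : ℕ
  n = 2 ℕ.+ a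

lemma1p1 : (n : ℕ) → n ≢ 1 →
    Ψ (mulP (powP X n) (powP X+1 n)) ≡ Ψ (mulP (powP X+1 n) (powP X+2 n))
lemma1p1 zero            _   = refl
lemma1p1 (suc zero)      n≢1 = ⊥-elim (n≢1 refl)
lemma1p1 n@(suc (suc a)) _   = begin
  Ψ (mulP (powP X n) (powP X+1 n))             ≡⟨ Ψ≡ΛB (mulP (powP X n) (powP X+1 n)) ⟩
  Λ B 0 (mulP (powP X n) (powP X+1 n))         ≡⟨ Λ-mulP B 0 (powP X n) (powP X+1 n) ⟩
  Λ (λ k → Λ B k (powP X+1 n)) 0 (powP X n)    ≡⟨ Λ-X^ (λ k → Λ B k (powP X+1 n)) 0 n ⟩
  Λ B n (powP X+1 n)                           ≡⟨ Λ-translation B ΛB-binomial n a ⟨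
  Λ (λ k → Λ B k (powP X+2 n)) 0 (powP X+1 n)  ≡⟨ Λ-mulP B 0 (powP X+1 n) (powP X+2 n) ⟨
  Λ B 0 (mulP (powP X+1 n) (powP X+2 n))       ≡⟨ Ψ≡ΛB (mulP (powP X+1 n) (powP X+2 n)) ⟨
  Ψ (mulP (powP X+1 n) (powP X+2 n)) ∎
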